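{- Define polynomials $P_n(X)\in\mathbb{Z}[X]$ by $P_0(X)=1$ and $P_n(X)=XP_{n-1}(X)-P_{n-1}(X+1)$ for $n\ge 1$. Let $k$ be a positive integer and write $$f_k(X,Y):=(X-Y)(X+1-Y)\cdots(X+k-1-Y)=\sum_{r=0}^{k}a_{r,k}(X)Y^r$$ with $a_{r,k}(X)\in\mathbb{Z}[X]$. Then for all integers $n\ge 0$, $$P_n(X+k)=\sum_{r=0}^{k}a_{r,k}(X)P_{n+r}(X).$$ -}

module Defs where

open import Data.Nat as ℕ using (ℕ; zero; suc)
open import Data.Integer as ℤ using (ℤ; +_; -[1+_])
open import Data.List using (List; []; _∷_; map; foldr; upTo)
open import Relation.Binary.PropositionalEquality using (_≡_)

-- Generic dense univariate polynomials over a coefficient type A,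
-- represented by coefficient lists (lowest degree first).
module PolyOps {A : Set} (0# : A) (_+_ _*_ : A → A → A) (-_ : A → A) where

  Poly : Set
  Poly = List A

  infixl 6 _⊕_
  infixl 7 _⊗_

  _⊕_ : Poly → Poly → Poly
  [] ⊕ q = q
  (a ∷ p) ⊕ [] = a ∷ p
  (a ∷ p) ⊕ (b ∷ q) = (a + b) ∷ (p ⊕ q)

  scale : A → Poly → Poly
  scale a p = map (a *_) p

  _⊗_ : Poly → Poly → Poly
  [] ⊗ q = []
  (a ∷ p) ⊗ q = scale a q ⊕ (0# ∷ (p ⊗ q))

  neg : Poly → Poly
  neg p = map -_ p

  coeff : Poly → ℕ → A
  coeff [] _ = 0#
  coeff (a ∷ p) zero = a
  coeff (a ∷ p) (suc i) = coeff p i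

  compose : Poly → Poly → Poly
  compose p q = foldr (λ a acc → (a ∷ []) ⊕ (q ⊗ acc)) [] p

  sumP : List Poly → Poly
  sumP = foldr _⊕_ []

open PolyOps (+ 0) ℤ._+_ ℤ._*_ ℤ.-_ public

ZPoly : Set
ZPoly = Poly

-- equality in ℤ[X]: all coefficients agree (trailing zeros irrelevant)
infix 4 _≈_
_≈_ : ZPoly → ZPoly → Set
p ≈ q = ∀ i → coeff p i ≡ coeff q i

X : ZPoly
X = + 0 ∷ + 1 ∷ []

shift : ZPoly → ℤ → ZPoly
shift p c = compose p (c ∷ + 1 ∷ [])

P : ℕ → ZPoly
P zero = + 1 ∷ []
P (suc n) = (X ⊗ P n) ⊕ neg (shift (P n) (+ 1))

-- ℤ[X][Y]: polynomials in Y with coefficients in ℤ[X]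
module B = PolyOps {ZPoly} [] _⊕_ _⊗_ neg

BiPoly : Set
BiPoly = B.Poly

f : ℕ → BiPoly
f zero = (+ 1 ∷ []) ∷ []
f (suc k) = f k B.⊗ ((+ k ∷ + 1 ∷ []) ∷ (-[1+ 0 ] ∷ []) ∷ [])

a : ℕ → ℕ → ZPoly
a r k = B.coeff (f k) r

module Submission where

-- Let E_Q be the linear functional on ℤ[X][Y] sending Y^r to Q_r, so that the
-- right-hand side is E_Q(f_k) for Q_r = P_{n+r}. The recurrence says
-- P_r(X+1) = X P_r − P_{r+1}; translating it by k gives
-- P_r(X+k+1) = (X+k) P_r(X+k) − P_{r+1}(X+k), while f_{k+1} = f_k · (X+k−Y)
-- and E_Q(g · (X+k−Y)) = (X+k) E_Q(g) − E_{Q∘suc}(g). So both sides satisfy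
-- the same recursion in k, for every sequence obeying the recurrence at once,
-- and agree at k = 0.

open import Defs using (module PolyOps)
open import Data.Nat using (ℕ; zero; suc; _≤_; z≤n; s≤s)
open import Data.Integer using (+_; -[1+_])
open import Data.Integer.Properties using (+-*-commutativeRing)
open import Data.List using ([]; _∷_; length; foldr; map; upTo; applyUpTo)
open import Data.List.Properties using (map-applyUpTo)
open import Data.Product using (_,_)
open import Function using (id; _∘_)
open import Level using (0ℓ)
open import Algebra.Bundles using (AbelianGroup; CommutativeRing)
open import Relation.Binary.Bundles using (Setoid)
open import Relation.Binary.Structures using (IsEquivalence)
open import Relation.Binary.PropositionalEquality using (cong)
import Algebra.Properties.AbelianGroup as AbelianGroupProperties
import Algebra.Properties.CommutativeSemigroup as CommutativeSemigroupProperties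
import Algebra.Properties.Ring as RingProperties
import Relation.Binary.Reasoning.Setoid as SetoidReasoning

module Polynomial {ℓ} (R : CommutativeRing 0ℓ ℓ) where

  open CommutativeRing R
  open PolyOps 0# _+_ _*_ -_

  -- A record rather than the bare pointwise function type, so that both
  -- polynomials can be inferred from an equation between them.
  infix 4 _≋_
  record _≋_ (p q : Poly) : Set ℓ where
    constructor pointwise
    field coeff-≈ : ∀ i → coeff p i ≈ coeff q i
  open _≋_ public

  ≋-isEquivalence : IsEquivalence _≋_
  ≋-isEquivalence = record
    { refl  = pointwise λ i → refl
    ; sym   = λ p≋q → pointwise λ i → sym (coeff-≈ p≋q i)
    ; trans = λ p≋q q≋r → pointwise λ i → trans (coeff-≈ p≋q i) (coeff-≈ q≋r i)
    }

  ≋-setoid : Setoid 0ℓ ℓ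
  ≋-setoid = record { isEquivalence = ≋-isEquivalence }

  open IsEquivalence ≋-isEquivalence public
    using () renaming (refl to ≋-refl; sym to ≋-sym; trans to ≋-trans; reflexive to ≋-reflexive)

  module ≋-Reasoning = SetoidReasoning ≋-setoid

  ∷-cong : ∀ {x y p q} → x ≈ y → p ≋ q → x ∷ p ≋ y ∷ q
  ∷-cong x≈y p≋q = pointwise λ where
    zero    → x≈y
    (suc i) → coeff-≈ p≋q i

  ∷-zero : ∀ {x p} → x ≈ 0# → p ≋ [] → x ∷ p ≋ []
  ∷-zero x≈0 p≋[] = pointwise λ where
    zero    → x≈0
    (suc i) → coeff-≈ p≋[] i

  ∷-injectiveʳ : ∀ {x y p q} → x ∷ p ≋ y ∷ q → p ≋ q
  ∷-injectiveʳ e = pointwise λ i → coeff-≈ e (suc i)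

  ∷-zeroʳ : ∀ {x p} → x ∷ p ≋ [] → p ≋ []
  ∷-zeroʳ e = pointwise λ i → coeff-≈ e (suc i)

  coeff-⊕ : ∀ p q i → coeff (p ⊕ q) i ≈ coeff p i + coeff q i
  coeff-⊕ []      q       i       = sym (+-identityˡ _)
  coeff-⊕ (x ∷ p) []      i       = sym (+-identityʳ _)
  coeff-⊕ (x ∷ p) (y ∷ q) zero    = refl
  coeff-⊕ (x ∷ p) (y ∷ q) (suc i) = coeff-⊕ p q i

  coeff-scale : ∀ c p i → coeff (scale c p) i ≈ c * coeff p i
  coeff-scale c []      i       = sym (zeroʳ c)
  coeff-scale c (x ∷ p) zero    = refl
  coeff-scale c (x ∷ p) (suc i) = coeff-scale c p i

  coeff-neg : ∀ p i → coeff (neg p) i ≈ - coeff p i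
  coeff-neg []      i       = sym -0#≈0#
    where open RingProperties ring using (-0#≈0#)
  coeff-neg (x ∷ p) zero    = refl
  coeff-neg (x ∷ p) (suc i) = coeff-neg p i

  ⊕-cong : ∀ {p p′ q q′} → p ≋ p′ → q ≋ q′ → p ⊕ q ≋ p′ ⊕ q′
  ⊕-cong {p} {p′} {q} {q′} p≋p′ q≋q′ = pointwise λ i →
    trans (coeff-⊕ p q i) (trans (+-cong (coeff-≈ p≋p′ i) (coeff-≈ q≋q′ i)) (sym (coeff-⊕ p′ q′ i)))

  scale-cong : ∀ {c c′ p p′} → c ≈ c′ → p ≋ p′ → scale c p ≋ scale c′ p′
  scale-cong {c} {c′} {p} {p′} c≈c′ p≋p′ = pointwise λ i →
    trans (coeff-scale c p i) (trans (*-cong c≈c′ (coeff-≈ p≋p′ i)) (sym (coeff-scale c′ p′ i)))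

  neg-cong : ∀ {p p′} → p ≋ p′ → neg p ≋ neg p′
  neg-cong {p} {p′} p≋p′ = pointwise λ i →
    trans (coeff-neg p i) (trans (-‿cong (coeff-≈ p≋p′ i)) (sym (coeff-neg p′ i)))

  ⊕-congˡ : ∀ p {q q′} → q ≋ q′ → p ⊕ q ≋ p ⊕ q′
  ⊕-congˡ p = ⊕-cong ≋-refl

  ⊕-congʳ : ∀ q {p p′} → p ≋ p′ → p ⊕ q ≋ p′ ⊕ q
  ⊕-congʳ q p≋p′ = ⊕-cong p≋p′ ≋-refl

  ⊕-assoc : ∀ p q r → (p ⊕ q) ⊕ r ≋ p ⊕ (q ⊕ r)
  ⊕-assoc []      q       r       = ≋-refl
  ⊕-assoc (x ∷ p) []      r       = ≋-refl
  ⊕-assoc (x ∷ p) (y ∷ q) []      = ≋-refl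
  ⊕-assoc (x ∷ p) (y ∷ q) (z ∷ r) = ∷-cong (+-assoc x y z) (⊕-assoc p q r)

  ⊕-comm : ∀ p q → p ⊕ q ≋ q ⊕ p
  ⊕-comm []      []      = ≋-refl
  ⊕-comm []      (y ∷ q) = ≋-refl
  ⊕-comm (x ∷ p) []      = ≋-refl
  ⊕-comm (x ∷ p) (y ∷ q) = ∷-cong (+-comm x y) (⊕-comm p q)

  ⊕-identityʳ : ∀ p → p ⊕ [] ≋ p
  ⊕-identityʳ []      = ≋-refl
  ⊕-identityʳ (x ∷ p) = ≋-refl

  ⊕-inverseˡ : ∀ p → neg p ⊕ p ≋ []
  ⊕-inverseˡ []      = ≋-refl
  ⊕-inverseˡ (x ∷ p) = ∷-zero (-‿inverseˡ x) (⊕-inverseˡ p)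

  ⊕-inverseʳ : ∀ p → p ⊕ neg p ≋ []
  ⊕-inverseʳ []      = ≋-refl
  ⊕-inverseʳ (x ∷ p) = ∷-zero (-‿inverseʳ x) (⊕-inverseʳ p)

  ⊕-abelianGroup : AbelianGroup 0ℓ ℓ
  ⊕-abelianGroup = record
    { _≈_ = _≋_
    ; _∙_ = _⊕_
    ; ε   = []
    ; _⁻¹ = neg
    ; isAbelianGroup = record
      { isGroup = record
        { isMonoid = record
          { isSemigroup = record
            { isMagma = record { isEquivalence = ≋-isEquivalence ; ∙-cong = ⊕-cong }
            ; assoc   = ⊕-assoc
            }
          ; identity = (λ p → ≋-refl) , ⊕-identityʳ
          }
        ; inverse = ⊕-inverseˡ , ⊕-inverseʳ
        ; ⁻¹-cong = neg-cong
        }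
      ; comm = ⊕-comm
      }
    }

  open CommutativeSemigroupProperties (AbelianGroup.commutativeSemigroup ⊕-abelianGroup)
    using (interchange; x∙yz≈y∙xz)

  scale-⊕ : ∀ c p q → scale c (p ⊕ q) ≋ scale c p ⊕ scale c q
  scale-⊕ c []      q       = ≋-refl
  scale-⊕ c (x ∷ p) []      = ≋-refl
  scale-⊕ c (x ∷ p) (y ∷ q) = ∷-cong (distribˡ c x y) (scale-⊕ c p q)

  scale-+ : ∀ c d p → scale (c + d) p ≋ scale c p ⊕ scale d p
  scale-+ c d []      = ≋-refl
  scale-+ c d (x ∷ p) = ∷-cong (distribʳ x c d) (scale-+ c d p)

  scale-scale : ∀ c d p → scale c (scale d p) ≋ scale (c * d) p
  scale-scale c d []      = ≋-refl
  scale-scale c d (x ∷ p) = ∷-cong (sym (*-assoc c d x)) (scale-scale c d p)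

  scale-zero : ∀ p → scale 0# p ≋ []
  scale-zero []      = ≋-refl
  scale-zero (x ∷ p) = ∷-zero (zeroˡ x) (scale-zero p)

  scale-identity : ∀ p → scale 1# p ≋ p
  scale-identity []      = ≋-refl
  scale-identity (x ∷ p) = ∷-cong (*-identityˡ x) (scale-identity p)

  scale-∷0 : ∀ c p → 0# ∷ scale c p ≋ scale c (0# ∷ p)
  scale-∷0 c p = ∷-cong (sym (zeroʳ c)) ≋-refl

  ⊕-∷0 : ∀ p q → 0# ∷ (p ⊕ q) ≋ (0# ∷ p) ⊕ (0# ∷ q)
  ⊕-∷0 p q = ∷-cong (sym (+-identityˡ 0#)) ≋-refl

  ⊗-zeroʳ : ∀ p → p ⊗ [] ≋ []
  ⊗-zeroʳ []      = ≋-refl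
  ⊗-zeroʳ (x ∷ p) = ∷-zero refl (⊗-zeroʳ p)

  ⊗-congˡ : ∀ p {q q′} → q ≋ q′ → p ⊗ q ≋ p ⊗ q′
  ⊗-congˡ []      q≋q′ = ≋-refl
  ⊗-congˡ (x ∷ p) q≋q′ = ⊕-cong (scale-cong refl q≋q′) (∷-cong refl (⊗-congˡ p q≋q′))

  ⊗-cons : ∀ p y q → p ⊗ (y ∷ q) ≋ scale y p ⊕ (0# ∷ p ⊗ q)
  ⊗-cons []      y q = ≋-sym (∷-zero refl ≋-refl)
  ⊗-cons (x ∷ p) y q = ∷-cong (+-congʳ (*-comm x y)) (begin
    scale x q ⊕ p ⊗ (y ∷ q)                  ≈⟨ ⊕-cong ≋-refl (⊗-cons p y q) ⟩
    scale x q ⊕ (scale y p ⊕ (0# ∷ p ⊗ q))   ≈⟨ x∙yz≈y∙xz (scale x q) (scale y p) (0# ∷ p ⊗ q) ⟩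
    scale y p ⊕ (scale x q ⊕ (0# ∷ p ⊗ q))   ∎)
    where open ≋-Reasoning

  ⊗-comm : ∀ p q → p ⊗ q ≋ q ⊗ p
  ⊗-comm []      q = ≋-sym (⊗-zeroʳ q)
  ⊗-comm (x ∷ p) q = ≋-trans (⊕-cong ≋-refl (∷-cong refl (⊗-comm p q))) (≋-sym (⊗-cons q x p))

  ⊗-cong : ∀ {p p′ q q′} → p ≋ p′ → q ≋ q′ → p ⊗ q ≋ p′ ⊗ q′
  ⊗-cong {p} {p′} {q} {q′} p≋p′ q≋q′ = begin
    p ⊗ q    ≈⟨ ⊗-congˡ p q≋q′ ⟩
    p ⊗ q′   ≈⟨ ⊗-comm p q′ ⟩
    q′ ⊗ p   ≈⟨ ⊗-congˡ q′ p≋p′ ⟩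
    q′ ⊗ p′  ≈⟨ ⊗-comm q′ p′ ⟩
    p′ ⊗ q′  ∎
    where open ≋-Reasoning

  scale-⊗ : ∀ c p q → scale c p ⊗ q ≋ scale c (p ⊗ q)
  scale-⊗ c []      q = ≋-refl
  scale-⊗ c (x ∷ p) q = begin
    scale (c * x) q ⊕ (0# ∷ scale c p ⊗ q)        ≈⟨ ⊕-cong (≋-sym (scale-scale c x q)) (∷-cong refl (scale-⊗ c p q)) ⟩
    scale c (scale x q) ⊕ (0# ∷ scale c (p ⊗ q))  ≈⟨ ⊕-cong ≋-refl (scale-∷0 c (p ⊗ q)) ⟩
    scale c (scale x q) ⊕ scale c (0# ∷ p ⊗ q)    ≈⟨ scale-⊕ c (scale x q) (0# ∷ p ⊗ q) ⟨
    scale c (scale x q ⊕ (0# ∷ p ⊗ q))            ∎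
    where open ≋-Reasoning

  ⊗-distribʳ : ∀ q p p′ → (p ⊕ p′) ⊗ q ≋ p ⊗ q ⊕ p′ ⊗ q
  ⊗-distribʳ q []      p′       = ≋-refl
  ⊗-distribʳ q (x ∷ p) []       = ≋-sym (⊕-identityʳ _)
  ⊗-distribʳ q (x ∷ p) (y ∷ p′) = begin
    scale (x + y) q ⊕ (0# ∷ (p ⊕ p′) ⊗ q)
      ≈⟨ ⊕-cong (scale-+ x y q) (≋-trans (∷-cong refl (⊗-distribʳ q p p′)) (⊕-∷0 (p ⊗ q) (p′ ⊗ q))) ⟩
    (scale x q ⊕ scale y q) ⊕ ((0# ∷ p ⊗ q) ⊕ (0# ∷ p′ ⊗ q))
      ≈⟨ interchange (scale x q) (scale y q) (0# ∷ p ⊗ q) (0# ∷ p′ ⊗ q) ⟩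
    (scale x q ⊕ (0# ∷ p ⊗ q)) ⊕ (scale y q ⊕ (0# ∷ p′ ⊗ q))
      ∎
    where open ≋-Reasoning

  ⊗-distribˡ : ∀ p q q′ → p ⊗ (q ⊕ q′) ≋ p ⊗ q ⊕ p ⊗ q′
  ⊗-distribˡ p q q′ = begin
    p ⊗ (q ⊕ q′)       ≈⟨ ⊗-comm p (q ⊕ q′) ⟩
    (q ⊕ q′) ⊗ p       ≈⟨ ⊗-distribʳ p q q′ ⟩
    q ⊗ p ⊕ q′ ⊗ p     ≈⟨ ⊕-cong (⊗-comm q p) (⊗-comm q′ p) ⟩
    p ⊗ q ⊕ p ⊗ q′     ∎
    where open ≋-Reasoning

  ∷0-⊗ : ∀ p q → (0# ∷ p) ⊗ q ≋ 0# ∷ p ⊗ q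
  ∷0-⊗ p q = ⊕-cong (scale-zero q) ≋-refl

  ⊗-assoc : ∀ p q r → (p ⊗ q) ⊗ r ≋ p ⊗ (q ⊗ r)
  ⊗-assoc []      q r = ≋-refl
  ⊗-assoc (x ∷ p) q r = begin
    (scale x q ⊕ (0# ∷ p ⊗ q)) ⊗ r          ≈⟨ ⊗-distribʳ r (scale x q) (0# ∷ p ⊗ q) ⟩
    scale x q ⊗ r ⊕ (0# ∷ p ⊗ q) ⊗ r        ≈⟨ ⊕-cong (scale-⊗ x q r) (∷0-⊗ (p ⊗ q) r) ⟩
    scale x (q ⊗ r) ⊕ (0# ∷ (p ⊗ q) ⊗ r)    ≈⟨ ⊕-cong ≋-refl (∷-cong refl (⊗-assoc p q r)) ⟩
    scale x (q ⊗ r) ⊕ (0# ∷ p ⊗ (q ⊗ r))    ∎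
    where open ≋-Reasoning

  const-⊗ : ∀ x p → (x ∷ []) ⊗ p ≋ scale x p
  const-⊗ x p = ≋-trans (⊕-cong ≋-refl (∷-zero refl ≋-refl)) (⊕-identityʳ (scale x p))

  ⊗-identityˡ : ∀ p → (1# ∷ []) ⊗ p ≋ p
  ⊗-identityˡ p = ≋-trans (const-⊗ 1# p) (scale-identity p)

  ⊗-identityʳ : ∀ p → p ⊗ (1# ∷ []) ≋ p
  ⊗-identityʳ p = ≋-trans (⊗-comm p (1# ∷ [])) (⊗-identityˡ p)

  commutativeRing : CommutativeRing 0ℓ ℓ
  commutativeRing = record
    { _≈_ = _≋_
    ; _+_ = _⊕_
    ; _*_ = _⊗_
    ; -_  = neg
    ; 0#  = []
    ; 1#  = 1# ∷ []
    ; isCommutativeRing = record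
      { isRing = record
        { +-isAbelianGroup = AbelianGroup.isAbelianGroup ⊕-abelianGroup
        ; *-cong     = ⊗-cong
        ; *-assoc    = ⊗-assoc
        ; *-identity = ⊗-identityˡ , ⊗-identityʳ
        ; distrib    = ⊗-distribˡ , ⊗-distribʳ
        }
      ; *-comm = ⊗-comm
      }
    }

  open AbelianGroupProperties ⊕-abelianGroup using (inverseˡ-unique; ⁻¹-anti-homo‿-; xyx⁻¹≈y)

  compose-zero : ∀ {p} s → p ≋ [] → compose p s ≋ []
  compose-zero {[]}    s p≋[] = ≋-refl
  compose-zero {x ∷ p} s p≋[] = ⊕-cong (∷-zero (coeff-≈ p≋[] 0) ≋-refl)
    (≋-trans (⊗-congˡ s (compose-zero s (∷-zeroʳ p≋[]))) (⊗-zeroʳ s))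

  compose-congʳ : ∀ {p p′} s → p ≋ p′ → compose p s ≋ compose p′ s
  compose-congʳ {[]}    {p′}     s p≋p′ = ≋-sym (compose-zero s (≋-sym p≋p′))
  compose-congʳ {x ∷ p} {[]}     s p≋p′ = compose-zero s p≋p′
  compose-congʳ {x ∷ p} {y ∷ p′} s p≋p′ = ⊕-cong (∷-cong (coeff-≈ p≋p′ 0) ≋-refl)
    (⊗-congˡ s (compose-congʳ s (∷-injectiveʳ p≋p′)))

  compose-congˡ : ∀ p {s s′} → s ≋ s′ → compose p s ≋ compose p s′
  compose-congˡ []      s≋s′ = ≋-refl
  compose-congˡ (x ∷ p) s≋s′ = ⊕-cong ≋-refl (⊗-cong s≋s′ (compose-congˡ p s≋s′))

  compose-const : ∀ x s → compose (x ∷ []) s ≋ x ∷ []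
  compose-const x s = ⊕-cong ≋-refl (⊗-zeroʳ s)

  compose-∷0 : ∀ p s → compose (0# ∷ p) s ≋ s ⊗ compose p s
  compose-∷0 p s = ⊕-cong (∷-zero refl ≋-refl) ≋-refl

  compose-⊕ : ∀ p q s → compose (p ⊕ q) s ≋ compose p s ⊕ compose q s
  compose-⊕ []      q       s = ≋-refl
  compose-⊕ (x ∷ p) []      s = ≋-sym (⊕-identityʳ _)
  compose-⊕ (x ∷ p) (y ∷ q) s = begin
    ((x ∷ []) ⊕ (y ∷ [])) ⊕ s ⊗ compose (p ⊕ q) s
      ≈⟨ ⊕-cong ≋-refl (≋-trans (⊗-congˡ s (compose-⊕ p q s)) (⊗-distribˡ s (compose p s) (compose q s))) ⟩
    ((x ∷ []) ⊕ (y ∷ [])) ⊕ (s ⊗ compose p s ⊕ s ⊗ compose q s)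
      ≈⟨ interchange (x ∷ []) (y ∷ []) (s ⊗ compose p s) (s ⊗ compose q s) ⟩
    ((x ∷ []) ⊕ s ⊗ compose p s) ⊕ ((y ∷ []) ⊕ s ⊗ compose q s)
      ∎
    where open ≋-Reasoning

  compose-scale : ∀ c p s → compose (scale c p) s ≋ scale c (compose p s)
  compose-scale c []      s = ≋-refl
  compose-scale c (x ∷ p) s = begin
    (c * x ∷ []) ⊕ s ⊗ compose (scale c p) s       ≈⟨ ⊕-cong ≋-refl (⊗-congˡ s (compose-scale c p s)) ⟩
    scale c (x ∷ []) ⊕ s ⊗ scale c (compose p s)   ≈⟨ ⊕-cong ≋-refl (⊗-comm s (scale c (compose p s))) ⟩
    scale c (x ∷ []) ⊕ scale c (compose p s) ⊗ s   ≈⟨ ⊕-cong ≋-refl (scale-⊗ c (compose p s) s) ⟩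
    scale c (x ∷ []) ⊕ scale c (compose p s ⊗ s)   ≈⟨ ⊕-cong ≋-refl (scale-cong refl (⊗-comm (compose p s) s)) ⟩
    scale c (x ∷ []) ⊕ scale c (s ⊗ compose p s)   ≈⟨ scale-⊕ c (x ∷ []) (s ⊗ compose p s) ⟨
    scale c ((x ∷ []) ⊕ s ⊗ compose p s)           ∎
    where open ≋-Reasoning

  compose-⊗ : ∀ p q s → compose (p ⊗ q) s ≋ compose p s ⊗ compose q s
  compose-⊗ []      q s = ≋-refl
  compose-⊗ (x ∷ p) q s = begin
    compose (scale x q ⊕ (0# ∷ p ⊗ q)) s
      ≈⟨ compose-⊕ (scale x q) (0# ∷ p ⊗ q) s ⟩
    compose (scale x q) s ⊕ compose (0# ∷ p ⊗ q) s
      ≈⟨ ⊕-cong (compose-scale x q s) (compose-∷0 (p ⊗ q) s) ⟩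
    scale x (compose q s) ⊕ s ⊗ compose (p ⊗ q) s
      ≈⟨ ⊕-cong ≋-refl (⊗-congˡ s (compose-⊗ p q s)) ⟩
    scale x (compose q s) ⊕ s ⊗ (compose p s ⊗ compose q s)
      ≈⟨ ⊕-cong (const-⊗ x (compose q s)) (⊗-assoc s (compose p s) (compose q s)) ⟨
    (x ∷ []) ⊗ compose q s ⊕ (s ⊗ compose p s) ⊗ compose q s
      ≈⟨ ⊗-distribʳ (compose q s) (x ∷ []) (s ⊗ compose p s) ⟨
    ((x ∷ []) ⊕ s ⊗ compose p s) ⊗ compose q s
      ∎
    where open ≋-Reasoning

  compose-neg : ∀ p s → compose (neg p) s ≋ neg (compose p s)
  compose-neg p s = inverseˡ-unique (compose (neg p) s) (compose p s) (begin
    compose (neg p) s ⊕ compose p s  ≈⟨ compose-⊕ (neg p) p s ⟨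
    compose (neg p ⊕ p) s            ≈⟨ compose-zero s (⊕-inverseˡ p) ⟩
    []                               ∎)
    where open ≋-Reasoning

  compose-assoc : ∀ p s t → compose (compose p s) t ≋ compose p (compose s t)
  compose-assoc []      s t = ≋-refl
  compose-assoc (x ∷ p) s t = begin
    compose ((x ∷ []) ⊕ s ⊗ compose p s) t
      ≈⟨ compose-⊕ (x ∷ []) (s ⊗ compose p s) t ⟩
    compose (x ∷ []) t ⊕ compose (s ⊗ compose p s) t
      ≈⟨ ⊕-cong (compose-const x t) (compose-⊗ s (compose p s) t) ⟩
    (x ∷ []) ⊕ compose s t ⊗ compose (compose p s) t
      ≈⟨ ⊕-cong ≋-refl (⊗-congˡ (compose s t) (compose-assoc p s t)) ⟩
    (x ∷ []) ⊕ compose s t ⊗ compose p (compose s t)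
      ∎
    where open ≋-Reasoning

  X+_ : Carrier → Poly
  X+ c = c ∷ 1# ∷ []

  compose-X+ : ∀ c s → compose (X+ c) s ≋ (c ∷ []) ⊕ s
  compose-X+ c s = ⊕-cong ≋-refl (≋-trans (⊗-congˡ s (compose-const 1# s)) (⊗-identityʳ s))

  compose-X+0 : ∀ p → compose p (X+ 0#) ≋ p
  compose-X+0 []      = ≋-refl
  compose-X+0 (x ∷ p) = ≋-trans (⊕-congˡ (x ∷ []) X+0⊗p≋0∷p) (∷-cong (+-identityʳ x) ≋-refl)
    where
    X+0⊗p≋0∷p : X+ 0# ⊗ compose p (X+ 0#) ≋ 0# ∷ p
    X+0⊗p≋0∷p = ⊕-cong (scale-zero _) (∷-cong refl (≋-trans (⊗-identityˡ _) (compose-X+0 p)))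

  compose-X+-X+ : ∀ p c d → compose (compose p (X+ c)) (X+ d) ≋ compose p (X+ (c + d))
  compose-X+-X+ p c d = ≋-trans (compose-assoc p (X+ c) (X+ d)) (compose-congˡ p (compose-X+ c (X+ d)))

  compose-X+-recurrence : ∀ p q c → q ≋ X+ 0# ⊗ p ⊕ neg (compose p (X+ 1#)) →
    compose p (X+ (1# + c)) ≋ X+ c ⊗ compose p (X+ c) ⊕ neg (compose q (X+ c))
  compose-X+-recurrence p q c q≋Xp-p₁ = begin
    compose p (X+ (1# + c))
      ≈⟨ compose-X+-X+ p 1# c ⟨
    compose (compose p (X+ 1#)) (X+ c)
      ≈⟨ compose-congʳ (X+ c) p₁≋Xp-q ⟩
    compose (X+ 0# ⊗ p ⊕ neg q) (X+ c)
      ≈⟨ compose-⊕ (X+ 0# ⊗ p) (neg q) (X+ c) ⟩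
    compose (X+ 0# ⊗ p) (X+ c) ⊕ compose (neg q) (X+ c)
      ≈⟨ ⊕-cong (compose-⊗ (X+ 0#) p (X+ c)) (compose-neg q (X+ c)) ⟩
    compose (X+ 0#) (X+ c) ⊗ compose p (X+ c) ⊕ neg (compose q (X+ c))
      ≈⟨ ⊕-congʳ (neg (compose q (X+ c))) (⊗-cong X+0∘X+c≋X+c ≋-refl) ⟩
    X+ c ⊗ compose p (X+ c) ⊕ neg (compose q (X+ c))
      ∎
    where
    open ≋-Reasoning
    X+0∘X+c≋X+c : compose (X+ 0#) (X+ c) ≋ X+ c
    X+0∘X+c≋X+c = ≋-trans (compose-X+ 0# (X+ c)) (∷-cong (+-identityˡ c) ≋-refl)
    Xp p₁ : Poly
    Xp = X+ 0# ⊗ p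
    p₁ = compose p (X+ 1#)
    p₁≋Xp-q : p₁ ≋ Xp ⊕ neg q
    p₁≋Xp-q = begin
      p₁                         ≈⟨ xyx⁻¹≈y Xp p₁ ⟨
      (Xp ⊕ p₁) ⊕ neg Xp         ≈⟨ ⊕-assoc Xp p₁ (neg Xp) ⟩
      Xp ⊕ (p₁ ⊕ neg Xp)         ≈⟨ ⊕-congˡ Xp (⁻¹-anti-homo‿- Xp p₁) ⟨
      Xp ⊕ neg (Xp ⊕ neg p₁)     ≈⟨ ⊕-congˡ Xp (neg-cong q≋Xp-p₁) ⟨
      Xp ⊕ neg q                 ∎

  ⊗-linear : ∀ p c d → p ⊗ (c ∷ d ∷ []) ≋ scale c p ⊕ (0# ∷ scale d p)
  ⊗-linear p c d = ≋-trans (⊗-cons p c (d ∷ []))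
    (⊕-cong ≋-refl (∷-cong refl (≋-trans (⊗-comm p (d ∷ [])) (const-⊗ d p))))

  length-⊕ : ∀ p q {n} → length p ≤ n → length q ≤ n → length (p ⊕ q) ≤ n
  length-⊕ []      q       p≤n       q≤n       = q≤n
  length-⊕ (x ∷ p) []      p≤n       q≤n       = p≤n
  length-⊕ (x ∷ p) (y ∷ q) (s≤s p≤n) (s≤s q≤n) = s≤s (length-⊕ p q p≤n q≤n)

  length-⊗-linear : ∀ p c d → length (p ⊗ (c ∷ d ∷ [])) ≤ suc (length p)
  length-⊗-linear []      c d = z≤n
  length-⊗-linear (x ∷ p) c d = length-⊕ (scale x (c ∷ d ∷ [])) (0# ∷ p ⊗ (c ∷ d ∷ []))
    (s≤s (s≤s z≤n)) (s≤s (length-⊗-linear p c d))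

  -- g(Y) with each power Y^r read as Q r.
  umbral : (ℕ → Carrier) → Poly → Carrier
  umbral Q []      = 0#
  umbral Q (h ∷ g) = h * Q 0 + umbral (Q ∘ suc) g

  umbral-zero : ∀ Q {g} → g ≋ [] → umbral Q g ≈ 0#
  umbral-zero Q {[]}    g≋[] = refl
  umbral-zero Q {h ∷ g} g≋[] = trans
    (+-cong (trans (*-congʳ (coeff-≈ g≋[] 0)) (zeroˡ (Q 0))) (umbral-zero (Q ∘ suc) (∷-zeroʳ g≋[])))
    (+-identityʳ 0#)

  umbral-cong : ∀ Q {g g′} → g ≋ g′ → umbral Q g ≈ umbral Q g′
  umbral-cong Q {[]}    {g′}      g≋g′ = sym (umbral-zero Q (≋-sym g≋g′))
  umbral-cong Q {h ∷ g} {[]}      g≋g′ = umbral-zero Q g≋g′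
  umbral-cong Q {h ∷ g} {h′ ∷ g′} g≋g′ =
    +-cong (*-congʳ (coeff-≈ g≋g′ 0)) (umbral-cong (Q ∘ suc) (∷-injectiveʳ g≋g′))

  umbral-⊕ : ∀ Q g g′ → umbral Q (g ⊕ g′) ≈ umbral Q g + umbral Q g′
  umbral-⊕ Q []      g′        = sym (+-identityˡ _)
  umbral-⊕ Q (h ∷ g) []        = sym (+-identityʳ _)
  umbral-⊕ Q (h ∷ g) (h′ ∷ g′) = begin
    (h + h′) * Q 0 + umbral (Q ∘ suc) (g ⊕ g′)
      ≈⟨ +-cong (distribʳ (Q 0) h h′) (umbral-⊕ (Q ∘ suc) g g′) ⟩
    (h * Q 0 + h′ * Q 0) + (umbral (Q ∘ suc) g + umbral (Q ∘ suc) g′)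
      ≈⟨ +-interchange (h * Q 0) (h′ * Q 0) (umbral (Q ∘ suc) g) (umbral (Q ∘ suc) g′) ⟩
    (h * Q 0 + umbral (Q ∘ suc) g) + (h′ * Q 0 + umbral (Q ∘ suc) g′)
      ∎
    where
    open SetoidReasoning setoid
    open CommutativeSemigroupProperties +-commutativeSemigroup using () renaming (interchange to +-interchange)

  umbral-scale : ∀ Q c g → umbral Q (scale c g) ≈ c * umbral Q g
  umbral-scale Q c []      = sym (zeroʳ c)
  umbral-scale Q c (h ∷ g) = trans
    (+-cong (*-assoc c h (Q 0)) (umbral-scale (Q ∘ suc) c g))
    (sym (distribˡ c (h * Q 0) (umbral (Q ∘ suc) g)))

  umbral-∷0 : ∀ Q g → umbral Q (0# ∷ g) ≈ umbral (Q ∘ suc) g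
  umbral-∷0 Q g = trans (+-congʳ (zeroˡ (Q 0))) (+-identityˡ _)

  umbral-⊗-linear : ∀ Q g c d → umbral Q (g ⊗ (c ∷ d ∷ [])) ≈ c * umbral Q g + d * umbral (Q ∘ suc) g
  umbral-⊗-linear Q g c d = begin
    umbral Q (g ⊗ (c ∷ d ∷ []))                       ≈⟨ umbral-cong Q (⊗-linear g c d) ⟩
    umbral Q (scale c g ⊕ (0# ∷ scale d g))           ≈⟨ umbral-⊕ Q (scale c g) (0# ∷ scale d g) ⟩
    umbral Q (scale c g) + umbral Q (0# ∷ scale d g)  ≈⟨ +-cong (umbral-scale Q c g) (umbral-∷0 Q (scale d g)) ⟩
    c * umbral Q g + umbral (Q ∘ suc) (scale d g)     ≈⟨ +-congˡ (umbral-scale (Q ∘ suc) d g) ⟩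
    c * umbral Q g + d * umbral (Q ∘ suc) g           ∎
    where open SetoidReasoning setoid

  umbral-as-sum : ∀ Q g m → length g ≤ m → umbral Q g ≈ foldr _+_ 0# (applyUpTo (λ r → coeff g r * Q r) m)
  umbral-as-sum Q []      zero    _         = refl
  umbral-as-sum Q []      (suc m) _         = trans
    (sym (+-identityʳ 0#))
    (+-cong (sym (zeroˡ (Q 0))) (umbral-as-sum (Q ∘ suc) [] m z≤n))
  umbral-as-sum Q (h ∷ g) (suc m) (s≤s g≤m) = +-congˡ (umbral-as-sum (Q ∘ suc) g m g≤m)

open Defs
open import Data.Nat using (_+_)
open import Data.Nat.Properties using (≤-trans; +-identityʳ; +-suc)

module ℤ[X] = Polynomial +-*-commutativeRing
module ℤ[X][Y] = Polynomial ℤ[X].commutativeRing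

open ℤ[X] using (_≋_; coeff-≈; ≋-refl; ≋-sym; ≋-trans; ≋-reflexive; module ≋-Reasoning;
  ⊕-cong; ⊕-congˡ; ⊗-congˡ; neg-cong; ⊕-identityʳ; ⊗-identityˡ; X+_; compose-X+0; compose-X+-recurrence)
open ℤ[X][Y] using (umbral; umbral-⊗-linear; umbral-as-sum; length-⊗-linear)
open RingProperties (CommutativeRing.ring ℤ[X].commutativeRing) using (-1*x≈-x)

length-f : ∀ k → length (f k) ≤ suc k
length-f zero    = s≤s z≤n
length-f (suc k) = ≤-trans (length-⊗-linear (f k) (X+ (+ k)) (-[1+ 0 ] ∷ [])) (s≤s (length-f k))

shift≋umbral : (Q : ℕ → ZPoly) → (∀ r → Q (suc r) ≋ X ⊗ Q r ⊕ neg (shift (Q r) (+ 1))) →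
  ∀ k → shift (Q 0) (+ k) ≋ umbral Q (f k)
shift≋umbral Q recurrence zero =
  ≋-trans (compose-X+0 (Q 0)) (≋-sym (≋-trans (⊕-identityʳ _) (⊗-identityˡ (Q 0))))
shift≋umbral Q recurrence (suc k) = begin
  shift (Q 0) (+ suc k)
    ≈⟨ compose-X+-recurrence (Q 0) (Q 1) (+ k) (recurrence 0) ⟩
  X+ (+ k) ⊗ shift (Q 0) (+ k) ⊕ neg (shift (Q 1) (+ k))
    ≈⟨ ⊕-cong (⊗-congˡ (X+ (+ k)) (shift≋umbral Q recurrence k))
              (neg-cong (shift≋umbral (Q ∘ suc) (recurrence ∘ suc) k)) ⟩
  X+ (+ k) ⊗ umbral Q (f k) ⊕ neg (umbral (Q ∘ suc) (f k))
    ≈⟨ ⊕-congˡ (X+ (+ k) ⊗ umbral Q (f k)) (-1*x≈-x (umbral (Q ∘ suc) (f k))) ⟨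
  X+ (+ k) ⊗ umbral Q (f k) ⊕ (-[1+ 0 ] ∷ []) ⊗ umbral (Q ∘ suc) (f k)
    ≈⟨ umbral-⊗-linear Q (f k) (X+ (+ k)) (-[1+ 0 ] ∷ []) ⟨
  umbral Q (f (suc k))
    ∎
  where open ≋-Reasoning

-- The identity also holds for k = 0.
proposition3p6 : (k : ℕ) → 1 ≤ k → (n : ℕ) →
    shift (P n) (+ k) ≈ sumP (map (λ r → a r k ⊗ P (n + r)) (upTo (suc k)))
proposition3p6 k _ n = coeff-≈ (begin
  shift (P n) (+ k)
    ≡⟨ cong (λ m → shift (P m) (+ k)) (+-identityʳ n) ⟨
  shift (Pₙ₊ 0) (+ k)
    ≈⟨ shift≋umbral Pₙ₊ (λ r → ≋-reflexive (cong P (+-suc n r))) k ⟩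
  umbral Pₙ₊ (f k)
    ≈⟨ umbral-as-sum Pₙ₊ (f k) (suc k) (length-f k) ⟩
  sumP (applyUpTo (λ r → a r k ⊗ Pₙ₊ r) (suc k))
    ≡⟨ cong sumP (map-applyUpTo id (λ r → a r k ⊗ Pₙ₊ r) (suc k)) ⟨
  sumP (map (λ r → a r k ⊗ P (n + r)) (upTo (suc k)))
    ∎)
  where
  open ≋-Reasoning
  Pₙ₊ : ℕ → ZPoly
  Pₙ₊ r = P (n + r)
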